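{- Let $\mathbf A$ be an A-algebra such that $(a\wedge1)^2=a\wedge1$ for all $a\in A$, and define $!:A\to A$ by $!a=a\wedge1$. Then $\langle\mathbf A,!\rangle$ is a girale.
   Context: A commutative residuated lattice is an algebra $\langle A,\wedge,\vee,\cdot,\to,1\rangle$ where $\langle A,\wedge,\vee\rangle$ is a lattice, $\langle A,\cdot,1\rangle$ is a commutative monoid, and $a\cdot b\le c\iff a\le b\to c$. An A-algebra is an algebra $\langle A,\wedge,\vee,\cdot,\to,1,0,\bot,\top\rangle$ whose $\{\wedge,\vee,\cdot,\to,1\}$-reduct is a commutative residuated lattice, $\bot$ and $\top$ are its least and greatest elements, and $(a\to0)\to0=a$ for all $a$. A girale is an expansion of an A-algebra by a unary operation $!$ satisfying for all $a,b$: $!1=1$; $!a\le a\wedge1$; $!a\cdot!b=!(a\wedge b)$; $!!a=!a$. -}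

module Defs where

open import Level using (Level; suc; _⊔_)
open import Relation.Binary.PropositionalEquality using (_≡_)
open import Data.Product using (_×_)
open import Algebra.Structures using (IsCommutativeMonoid)
open import Algebra.Lattice.Structures using (IsLattice)

record IsCRL {a : Level} (A : Set a)
             (_∧_ _∨_ _·_ _⇒_ : A → A → A) (one : A) : Set a where
  field
    isLattice           : IsLattice _≡_ _∨_ _∧_
    isCommutativeMonoid : IsCommutativeMonoid _≡_ _·_ one
  _≤_ : A → A → Set a
  x ≤ y = (x ∧ y) ≡ x
  field
    residuation₁ : ∀ x y z → (x · y) ≤ z → x ≤ (y ⇒ z)
    residuation₂ : ∀ x y z → x ≤ (y ⇒ z) → (x · y) ≤ z

record AAlgebra (a : Level) : Set (suc a) where
  field
    Carrier : Set a
    _∧_ _∨_ _·_ _⇒_ : Carrier → Carrier → Carrier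
    one zero bot top : Carrier
    isCRL : IsCRL Carrier _∧_ _∨_ _·_ _⇒_ one
  open IsCRL isCRL public
  field
    bot-least    : ∀ x → bot ≤ x
    top-greatest : ∀ x → x ≤ top
    involutive   : ∀ x → ((x ⇒ zero) ⇒ zero) ≡ x

record IsGirale {a : Level} (A : AAlgebra a) (! : AAlgebra.Carrier A → AAlgebra.Carrier A) : Set a where
  open AAlgebra A
  field
    !-one  : ! one ≡ one
    !-defl : ∀ x → ! x ≤ (x ∧ one)
    !-mult : ∀ x y → (! x · ! y) ≡ ! (x ∧ y)
    !-idem : ∀ x → ! (! x) ≡ ! x

{-# OPTIONS --safe #-}
-- Below 1 the product is bounded by the meet: a · b ≤ a · 1 ∧ 1 · b.  Conversely,
-- the hypothesis makes c = (a ∧ b) ∧ 1 idempotent, and c ≤ a ∧ 1, c ≤ b ∧ 1 give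
-- c = c · c ≤ (a ∧ 1) · (b ∧ 1).  The other girale axioms are lattice identities.
module Submission where

open import Defs
open import Level using (Level)
open import Relation.Binary.PropositionalEquality
  using (_≡_; sym; cong; subst; subst₂; module ≡-Reasoning)
open import Relation.Binary.Bundles using (Poset)
open import Relation.Binary.Lattice using (IsMeetSemilattice)
open import Algebra.Structures using (IsCommutativeMonoid; IsCommutativeBand)
open import Algebra.Bundles using (CommutativeSemigroup)
open import Algebra.Lattice.Bundles using (Lattice)
import Algebra.Lattice.Properties.Lattice as LatticeProperties
import Algebra.Properties.CommutativeSemigroup as CommutativeSemigroupProperties

-- The lattice order x ∧ y ≡ x is the symmetric form of the standard library's
-- left natural order x ≡ x ∧ y, through which the order facts are imported.
module ResiduatedLatticeProperties
  {a : Level} {A : Set a} {_∧_ _∨_ _·_ _⇒_ : A → A → A} {one : A}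
  (isCRL : IsCRL A _∧_ _∨_ _·_ _⇒_ one) where

  open IsCRL isCRL
  open IsCommutativeMonoid isCommutativeMonoid using (identityˡ; identityʳ; comm)

  private
    lattice : Lattice a a
    lattice = record { isLattice = isLattice }

  open LatticeProperties lattice
    using (∧-idem; ∧-isSemilattice; poset; ∧-isOrderTheoreticMeetSemilattice)

  private
    ∧-commutativeSemigroup : CommutativeSemigroup a a
    ∧-commutativeSemigroup = record
      { isCommutativeSemigroup = IsCommutativeBand.isCommutativeSemigroup ∧-isSemilattice }

  open CommutativeSemigroupProperties ∧-commutativeSemigroup using (interchange)

  private
    module ⊑ = Poset poset
    module ⊓ = IsMeetSemilattice ∧-isOrderTheoreticMeetSemilattice

  ≤-refl : ∀ x → x ≤ x
  ≤-refl = ∧-idem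

  ≤-trans : ∀ {x y z} → x ≤ y → y ≤ z → x ≤ z
  ≤-trans p q = sym (⊑.trans (sym p) (sym q))

  ≤-antisym : ∀ {x y} → x ≤ y → y ≤ x → x ≡ y
  ≤-antisym p q = ⊑.antisym (sym p) (sym q)

  x∧y≤x : ∀ x y → (x ∧ y) ≤ x
  x∧y≤x x y = sym (⊓.x∧y≤x x y)

  x∧y≤y : ∀ x y → (x ∧ y) ≤ y
  x∧y≤y x y = sym (⊓.x∧y≤y x y)

  ∧-greatest : ∀ {x y z} → x ≤ y → x ≤ z → x ≤ (y ∧ z)
  ∧-greatest p q = sym (⊓.∧-greatest (sym p) (sym q))

  ∧-distrib-∧ʳ : ∀ x y z → ((x ∧ z) ∧ (y ∧ z)) ≡ ((x ∧ y) ∧ z)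
  ∧-distrib-∧ʳ x y z = begin
    (x ∧ z) ∧ (y ∧ z)  ≡⟨ interchange x z y z ⟩
    (x ∧ y) ∧ (z ∧ z)  ≡⟨ cong ((x ∧ y) ∧_) (∧-idem z) ⟩
    (x ∧ y) ∧ z        ∎
    where open ≡-Reasoning

  ·-monoˡ-≤ : ∀ {x y} z → x ≤ y → (x · z) ≤ (y · z)
  ·-monoˡ-≤ {x} {y} z x≤y =
    residuation₂ x z (y · z) (≤-trans x≤y (residuation₁ y z (y · z) (≤-refl (y · z))))

  ·-monoʳ-≤ : ∀ {x y} z → x ≤ y → (z · x) ≤ (z · y)
  ·-monoʳ-≤ {x} {y} z x≤y =
    subst₂ _≤_ (comm x z) (comm y z) (·-monoˡ-≤ z x≤y)

  ·-mono-≤ : ∀ {x y u v} → x ≤ y → u ≤ v → (x · u) ≤ (y · v)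
  ·-mono-≤ {y = y} {u = u} x≤y u≤v = ≤-trans (·-monoˡ-≤ u x≤y) (·-monoʳ-≤ y u≤v)

  x≤1∧y≤1⇒x·y≤x∧y : ∀ {x y} → x ≤ one → y ≤ one → (x · y) ≤ (x ∧ y)
  x≤1∧y≤1⇒x·y≤x∧y {x} {y} x≤1 y≤1 = ∧-greatest
    (subst ((x · y) ≤_) (identityʳ x) (·-monoʳ-≤ x y≤1))
    (subst ((x · y) ≤_) (identityˡ y) (·-monoˡ-≤ y x≤1))

  z·z≡z⇒z≤x·y : ∀ {z x y} → (z · z) ≡ z → z ≤ x → z ≤ y → z ≤ (x · y)
  z·z≡z⇒z≤x·y z·z≡z z≤x z≤y = subst (_≤ _) z·z≡z (·-mono-≤ z≤x z≤y)

lemma3p3 : {a : Level} (A : AAlgebra a) → (∀ x → (AAlgebra._·_ A (AAlgebra._∧_ A x (AAlgebra.one A)) (AAlgebra._∧_ A x (AAlgebra.one A))) ≡ AAlgebra._∧_ A x (AAlgebra.one A)) → IsGirale A (λ x → AAlgebra._∧_ A x (AAlgebra.one A))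
lemma3p3 A !-idempotent = record
  { !-one  = ≤-refl one
  ; !-defl = λ x → ≤-refl (x ∧ one)
  ; !-mult = !-mult
  ; !-idem = λ x → x∧y≤y x one
  }
  where
  open AAlgebra A
  open ResiduatedLatticeProperties isCRL

  !-mult : ∀ x y → ((x ∧ one) · (y ∧ one)) ≡ ((x ∧ y) ∧ one)
  !-mult x y = ≤-antisym product≤meet meet≤product
    where
    meet-eq : ((x ∧ one) ∧ (y ∧ one)) ≡ ((x ∧ y) ∧ one)
    meet-eq = ∧-distrib-∧ʳ x y one

    product≤meet : ((x ∧ one) · (y ∧ one)) ≤ ((x ∧ y) ∧ one)
    product≤meet = subst (((x ∧ one) · (y ∧ one)) ≤_) meet-eq
      (x≤1∧y≤1⇒x·y≤x∧y (x∧y≤y x one) (x∧y≤y y one))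

    meet≤product : ((x ∧ y) ∧ one) ≤ ((x ∧ one) · (y ∧ one))
    meet≤product = z·z≡z⇒z≤x·y (!-idempotent (x ∧ y))
      (subst (_≤ (x ∧ one)) meet-eq (x∧y≤x (x ∧ one) (y ∧ one)))
      (subst (_≤ (y ∧ one)) meet-eq (x∧y≤y (x ∧ one) (y ∧ one)))
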